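{- Let $A$ be a distributive meet-complemented lattice in which both $\Box a$ and $\Diamond a$ exist for every $a\in A$, and suppose $\Box a\le\Box\Box a$ for every $a\in A$. Then for every $a\in A$: (i) $\Diamond\neg\Box a=\neg\Box a$; (ii) $\neg\neg\Diamond a\le\Diamond a$; (iii) $\neg\Box\neg a\le\Diamond a$; (iv) $\Diamond a=\neg\Box\neg a$.
   Context: A meet-complemented lattice is a lattice $(A,\wedge,\vee)$ such that for every $a\in A$ the element $\neg a=\max\{b\in A: a\wedge b\le c\text{ for all }c\in A\}$ exists; it is bounded, with least element $0$ and greatest element $1$. For $a\in A$, $\Box a=\max\{b\in A: a\vee\neg b=1\}$ and $\Diamond a=\min\{b\in A: \neg a\vee b=1\}$. -}

module Defs where

open import Level using (Level; _⊔_)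
open import Data.Product using (_×_)
open import Relation.Binary.Lattice.Bundles using (DistributiveLattice)

module MeetComplemented {c ℓ₁ ℓ₂ : Level} (L : DistributiveLattice c ℓ₁ ℓ₂) where
  open DistributiveLattice L

  IsMaximum : (Carrier → Set (c ⊔ ℓ₂)) → Carrier → Set (c ⊔ ℓ₂)
  IsMaximum P x = P x × (∀ y → P y → y ≤ x)

  IsMinimum : (Carrier → Set (c ⊔ ℓ₂)) → Carrier → Set (c ⊔ ℓ₂)
  IsMinimum P x = P x × (∀ y → P y → x ≤ y)

  IsOne : Carrier → Set (c ⊔ ℓ₂)
  IsOne x = ∀ d → d ≤ x

  IsNeg : Carrier → Carrier → Set (c ⊔ ℓ₂)
  IsNeg a = IsMaximum (λ b → ∀ d → a ∧ b ≤ d)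

  module WithNeg (¬_ : Carrier → Carrier) where
    IsBox : Carrier → Carrier → Set (c ⊔ ℓ₂)
    IsBox a = IsMaximum (λ b → IsOne (a ∨ ¬ b))

    IsDiamond : Carrier → Carrier → Set (c ⊔ ℓ₂)
    IsDiamond a = IsMinimum (λ b → IsOne (¬ a ∨ b))

-- In a distributive lattice with meet-complement ¬, the operators
-- □a = max{b : a ∨ ¬b = 1} and ◇a = min{b : ¬a ∨ b = 1} satisfy, without any
-- further hypothesis, a ≤ ◇a, a ≤ □◇a, ¬◇a ≤ □¬a and ◇a ≤ ¬□¬a.
-- The key tool is that x ∨ y = 1 together with z ∧ y = 0 forces z ≤ x
-- (distributivity).  An element x with x ≤ □x satisfies x ∨ ¬x = 1, and every
-- such complemented element is ¬¬-stable.
-- The axiom 4 (□a ≤ □□a) is used exactly twice: to show ◇¬□a = ¬□a (i) and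
-- to show ◇a ≤ □◇a.  The latter makes ◇a complemented, giving ¬¬◇a ≤ ◇a (ii);
-- (iii) follows from ¬◇a ≤ □¬a by antitonicity of ¬, and (iv) combines (iii)
-- with ◇a ≤ ¬□¬a.
module Submission where

open import Defs
open import Level using (Level)
open import Data.Product using (_×_; _,_; proj₁; proj₂)
open import Relation.Binary.Lattice.Bundles using (DistributiveLattice)

module Lattice {c ℓ₁ ℓ₂ : Level} (L : DistributiveLattice c ℓ₁ ℓ₂) where
  open DistributiveLattice L public
  open MeetComplemented L public

  ∨-mono : ∀ {a b x y} → a ≤ x → b ≤ y → a ∨ b ≤ x ∨ y
  ∨-mono p q = ∨-least (trans p (x≤x∨y _ _)) (trans q (y≤x∨y _ _))

  ∧-swap : ∀ {a b} → a ∧ b ≤ b ∧ a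
  ∧-swap = ∧-greatest (x∧y≤y _ _) (x∧y≤x _ _)

  one-mono : ∀ {x y} → IsOne x → x ≤ y → IsOne y
  one-mono o p d = trans (o d) p

  one-comm : ∀ {x y} → IsOne (x ∨ y) → IsOne (y ∨ x)
  one-comm o = one-mono o (∨-least (y≤x∨y _ _) (x≤x∨y _ _))

  below-of-cover : ∀ {x y z} → IsOne (x ∨ y) → (∀ d → z ∧ y ≤ d) → z ≤ x
  below-of-cover {x} {y} {z} cover disjoint = begin
    z                   ≤⟨ ∧-greatest refl (cover z) ⟩
    z ∧ (x ∨ y)         ≈⟨ ∧-distribˡ-∨ z x y ⟩
    (z ∧ x) ∨ (z ∧ y)   ≤⟨ ∨-least (x∧y≤y _ _) (disjoint x) ⟩
    x                   ∎
    where open import Relation.Binary.Reasoning.PartialOrder poset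

module Negation {c ℓ₁ ℓ₂ : Level} (L : DistributiveLattice c ℓ₁ ℓ₂)
                (¬_ : DistributiveLattice.Carrier L → DistributiveLattice.Carrier L)
                (negP : ∀ a → MeetComplemented.IsNeg L a (¬ a)) where
  open Lattice L

  neg-disjoint : ∀ a d → a ∧ ¬ a ≤ d
  neg-disjoint a = proj₁ (negP a)

  neg-intro : ∀ {a b} → (∀ d → a ∧ b ≤ d) → b ≤ ¬ a
  neg-intro {a} {b} = proj₂ (negP a) b

  neg-disjoint′ : ∀ a d → ¬ a ∧ a ≤ d
  neg-disjoint′ a d = trans ∧-swap (neg-disjoint a d)

  neg-antitone : ∀ {a b} → a ≤ b → ¬ b ≤ ¬ a
  neg-antitone {a} {b} a≤b =
    neg-intro (λ d → trans (∧-greatest (trans (x∧y≤x _ _) a≤b) (x∧y≤y _ _))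
                           (neg-disjoint b d))

  double-neg-intro : ∀ {a} → a ≤ ¬ (¬ a)
  double-neg-intro {a} = neg-intro (neg-disjoint′ a)

  complemented-stable : ∀ {x} → IsOne (x ∨ ¬ x) → ¬ (¬ x) ≤ x
  complemented-stable {x} cover = below-of-cover cover (neg-disjoint′ (¬ x))

  open WithNeg ¬_

  module Modal (□ ◇ : Carrier → Carrier)
               (boxP : ∀ a → IsBox a (□ a))
               (diaP : ∀ a → IsDiamond a (◇ a)) where

    box-cover : ∀ a → IsOne (a ∨ ¬ (□ a))
    box-cover a = proj₁ (boxP a)

    box-greatest : ∀ a b → IsOne (a ∨ ¬ b) → b ≤ □ a
    box-greatest a = proj₂ (boxP a)

    dia-cover : ∀ a → IsOne (¬ a ∨ ◇ a)
    dia-cover a = proj₁ (diaP a)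

    dia-least : ∀ a b → IsOne (¬ a ∨ b) → ◇ a ≤ b
    dia-least a = proj₂ (diaP a)

    dia-inflationary : ∀ a → a ≤ ◇ a
    dia-inflationary a = below-of-cover (one-comm (dia-cover a)) (neg-disjoint a)

    below-box-dia : ∀ a → a ≤ □ (◇ a)
    below-box-dia a = box-greatest (◇ a) a (one-comm (dia-cover a))

    neg-dia-below-box-neg : ∀ a → ¬ (◇ a) ≤ □ (¬ a)
    neg-dia-below-box-neg a =
      box-greatest (¬ a) (¬ (◇ a)) (one-mono (dia-cover a) (∨-mono refl double-neg-intro))

    dia-below-neg-box-neg : ∀ a → ◇ a ≤ ¬ (□ (¬ a))
    dia-below-neg-box-neg a = dia-least a _ (box-cover (¬ a))

    -- A □-fixed element (x ≤ □x) is complemented: x ∨ ¬x ≥ x ∨ ¬□x = 1.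
    box-fixed-complemented : ∀ {x} → x ≤ □ x → IsOne (x ∨ ¬ x)
    box-fixed-complemented {x} x≤□x =
      one-mono (box-cover x) (∨-mono refl (neg-antitone x≤□x))

    module Four (four : ∀ a → □ a ≤ □ (□ a)) where

      -- (i): ¬¬□a ∨ ¬□a ≥ □a ∨ ¬□□a = 1 (using axiom 4), so ◇¬□a ≤ ¬□a.
      dia-neg-box : ∀ a → ◇ (¬ (□ a)) ≈ ¬ (□ a)
      dia-neg-box a = antisym
        (dia-least _ _ (one-mono (box-cover (□ a))
                         (∨-mono double-neg-intro (neg-antitone (four a)))))
        (dia-inflationary _)

      -- ◇a is □-fixed: with g = □◇a we have a ≤ g ≤ □g (axiom 4), hence
      -- ¬□g ≤ ¬a, so ¬a ∨ g ≥ g ∨ ¬□g = 1 and ◇a ≤ g by minimality of ◇a.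
      dia-below-box-dia : ∀ a → ◇ a ≤ □ (◇ a)
      dia-below-box-dia a = dia-least a g (one-mono (box-cover g)
        (∨-least (y≤x∨y _ _)
                 (trans (neg-antitone (trans (below-box-dia a) (four (◇ a))))
                        (x≤x∨y _ _))))
        where g = □ (◇ a)

      dia-stable : ∀ a → ¬ (¬ (◇ a)) ≤ ◇ a
      dia-stable a = complemented-stable (box-fixed-complemented (dia-below-box-dia a))

      neg-box-neg-below-dia : ∀ a → ¬ (□ (¬ a)) ≤ ◇ a
      neg-box-neg-below-dia a =
        trans (neg-antitone (neg-dia-below-box-neg a)) (dia-stable a)

proposition23 : {c ℓ₁ ℓ₂ : Level} (L : DistributiveLattice c ℓ₁ ℓ₂) →
    let open DistributiveLattice L
        open MeetComplemented L
    in (¬_ : Carrier → Carrier) → (∀ a → IsNeg a (¬ a)) →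
       (□ ◇ : Carrier → Carrier) →
       (∀ a → WithNeg.IsBox ¬_ a (□ a)) →
       (∀ a → WithNeg.IsDiamond ¬_ a (◇ a)) →
       (∀ a → □ a ≤ □ (□ a)) →
       ∀ a → (◇ (¬ (□ a)) ≈ ¬ (□ a))
           × (¬ (¬ (◇ a)) ≤ ◇ a)
           × (¬ (□ (¬ a)) ≤ ◇ a)
           × (◇ a ≈ ¬ (□ (¬ a)))
proposition23 L ¬_ negP □ ◇ boxP diaP four a =
    dia-neg-box a
  , dia-stable a
  , neg-box-neg-below-dia a
  , antisym (dia-below-neg-box-neg a) (neg-box-neg-below-dia a)
  where
    open Lattice L using (antisym)
    open Negation L ¬_ negP
    open Modal □ ◇ boxP diaP
    open Four four
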